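{- Let $G=(X\,\dot\cup\,Y,E)$ be a finite bipartite graph, let $M$ be a maximum-cardinality matching in $G$, and let $X_0\subseteq X$ be the set of vertices of $X$ unmatched by $M$. Let $X_0-Y_1-X_1-Y_2-\cdots$ be the maximal $M$-alternating sequence starting at $X_0$, and set $X_S:=\bigcup_{i\ge0}X_i$, $X_L:=X\setminus X_S$, $Y_S:=\bigcup_{i\ge1}Y_i$, $Y_L:=Y\setminus Y_S$. Then: (a) there are no edges between $X_S$ and $Y_L$; (b) the subgraph $G[X_S,Y_S]$ is $Y$-path-saturated; (c) the subgraph $G[X_L,Y_L]$ is $X$-saturated, i.e. admits a matching saturating $X_L$.
   Context: Given a matching $M$ and a set $X_0\subseteq X$ of $M$-unmatched vertices, the $M$-alternating sequence starting at $X_0$ is the sequence of sets defined for $i\ge1$ by $Y_i:=N_{G\setminus M}(X_{i-1})\setminus\bigcup_{j<i}Y_j$ (neighbours of $X_{i-1}$ via edges not in $M$, excluding earlier $Y_j$) and $X_i:=N_M(Y_i)$ (the vertices matched by $M$ to vertices of $Y_i$); the maximal sequence is this sequence stopped just before the first empty set. $G[X',Y']$ denotes the induced subgraph on $X'\,\dot\cup\,Y'$. A bipartite graph $H=(A\,\dot\cup\,B,F)$ ($A$ the $X$-side) is \emph{$Y$-path-saturated} if for some integer $k\ge1$ there are partitions $A=A_0\,\dot\cup\cdots\dot\cup\,A_k$, $B=B_1\,\dot\cup\cdots\dot\cup\,B_k$ (parts may be empty) such that for all $i\ge1$ there is a perfect matching between $A_i$ and $B_i$ and every vertex of $B_i$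 has a neighbour in $A_{i-1}$. -}

module Defs where

open import Data.Nat using (ℕ; zero; suc; _+_; _≤_; _<_)
open import Data.Fin using (Fin; zero; suc)
open import Data.Bool using (Bool; true; false; if_then_else_)
open import Data.Product using (Σ; ∃; _×_; _,_)
open import Data.Sum using (_⊎_)
open import Data.Empty using (⊥)
open import Relation.Nullary using (¬_)
open import Relation.Binary.PropositionalEquality using (_≡_)

-- A finite bipartite graph G = (X ∪ Y, E) with X = Fin m, Y = Fin n,
-- given by its bipartite adjacency relation E x y ≡ true.

Σ[<_]_ : (k : ℕ) → (Fin k → ℕ) → ℕ
Σ[< zero ] f = 0
Σ[< suc k ] f = f zero + Σ[< k ] (λ i → f (suc i))

size : {m n : ℕ} → (Fin m → Fin n → Bool) → ℕ
size {m} {n} F = Σ[< m ] (λ x → Σ[< n ] (λ y → if F x y then 1 else 0))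

record IsMatching {m n : ℕ} (E F : Fin m → Fin n → Bool) : Set where
  field
    sub   : ∀ x y → F x y ≡ true → E x y ≡ true
    uniqX : ∀ x y y' → F x y ≡ true → F x y' ≡ true → y ≡ y'
    uniqY : ∀ x x' y → F x y ≡ true → F x' y ≡ true → x ≡ x'

record IsMaximumMatching {m n : ℕ} (E M : Fin m → Fin n → Bool) : Set where
  field
    matching : IsMatching E M
    maximum  : ∀ (F : Fin m → Fin n → Bool) → IsMatching E F → size F ≤ size M

record IsMatchingIn {m n : ℕ} (E : Fin m → Fin n → Bool)
         (A : Fin m → Set) (B : Fin n → Set) (F : Fin m → Fin n → Bool) : Set where
  field
    matching : IsMatching E F
    inside   : ∀ x y → F x y ≡ true → A x × B y

Unmatched : {m n : ℕ} → (Fin m → Fin n → Bool) → Fin m → Set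
Unmatched M x = ∀ y → M x y ≡ false

-- State after step i of the alternating sequence:
-- the sets X_i, Y_i and the union Y_1 ∪ ... ∪ Y_i.
record AltState (m n : ℕ) : Set₁ where
  constructor st
  field
    Xi : Fin m → Set
    Yi : Fin n → Set
    Ui : Fin n → Set

-- The M-alternating sequence starting at X₀ (indexed by all i ∈ ℕ; once a
-- set is empty all later ones are empty, so unions over ℕ equal unions over
-- the maximal sequence).
altSeq : {m n : ℕ} → (E M : Fin m → Fin n → Bool) → (Fin m → Set) → ℕ → AltState m n
altSeq E M X₀ zero = st X₀ (λ _ → ⊥) (λ _ → ⊥)
altSeq {m} {n} E M X₀ (suc i) = st X' Y' U'
  where
    open AltState (altSeq E M X₀ i)
    Y' : Fin n → Set
    Y' y = (∃ λ x → Xi x × E x y ≡ true × M x y ≡ false) × ¬ Ui y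
    X' : Fin m → Set
    X' x = ∃ λ y → Y' y × M x y ≡ true
    U' : Fin n → Set
    U' y = Ui y ⊎ Y' y

Xseq : {m n : ℕ} → (E M : Fin m → Fin n → Bool) → (Fin m → Set) → ℕ → Fin m → Set
Xseq E M X₀ i = AltState.Xi (altSeq E M X₀ i)

Yseq : {m n : ℕ} → (E M : Fin m → Fin n → Bool) → (Fin m → Set) → ℕ → Fin n → Set
Yseq E M X₀ i = AltState.Yi (altSeq E M X₀ i)

record YPathSaturated {m n : ℕ} (E : Fin m → Fin n → Bool)
         (A : Fin m → Set) (B : Fin n → Set) : Set₁ where
  field
    k       : ℕ
    k≥1     : 1 ≤ k
    As      : ℕ → Fin m → Set
    Bs      : ℕ → Fin n → Set
    As-sub  : ∀ i x → As i x → i ≤ k × A x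
    As-cov  : ∀ x → A x → ∃ λ i → As i x
    As-disj : ∀ i j x → As i x → As j x → i ≡ j
    Bs-sub  : ∀ i y → Bs i y → 1 ≤ i × i ≤ k × B y
    Bs-cov  : ∀ y → B y → ∃ λ i → Bs i y
    Bs-disj : ∀ i j y → Bs i y → Bs j y → i ≡ j
    perfect : ∀ i → 1 ≤ i → i ≤ k →
                Σ (Fin m → Fin n → Bool) λ F →
                  IsMatchingIn E (As i) (Bs i) F
                  × (∀ x → As i x → ∃ λ y → F x y ≡ true)
                  × (∀ y → Bs i y → ∃ λ x → F x y ≡ true)
    back    : ∀ i y → Bs (suc i) y → ∃ λ x → As i x × E x y ≡ true

module Submission where

-- The key fact is Berge's: M has no augmenting path.  An alternating path
-- from an unmatched vertex of X to an unmatched vertex y of Y is flipped one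
-- edge pair at a time ('redirect' moves the matching edge of one X-vertex),
-- which yields a strictly larger matching ('augment').  Every vertex of
-- Y_{i+1} ends such a path read off the sequence, so it is M-matched.  Then
--   (a) an edge from X_i to y either lies outside M (so y joins some Y_j) or
--       lies in M (so i ≥ 1 and y ∈ Y_i);
--   (b) the parts A_i = X_i, B_i = Y_i work with k = n+1: M restricted to Y_i
--       is a perfect matching of G[X_i,Y_i], and X_i is empty for i > n
--       because each nonempty step discovers a new vertex of Y;
--   (c) M restricted to X_L saturates X_L and lands in Y_L.
-- All sets are predicates, so we also show they are decidable (X_S via the
-- same length bound): this is what allows restricted matchings to be defined
-- as Boolean relations.

open import Defs
open import Data.Nat using (ℕ; zero; suc; _+_; _≤_; _<_; z≤n; s≤s)
open import Data.Nat.Properties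
  using (+-mono-≤; +-mono-<-≤; +-mono-≤-<; +-suc; <-cmp; ≤-trans; ≤-refl; ≤-reflexive; <⇒≱; m≤n⇒m<n∨m≡n; m≤n⇒m≤1+n)
open import Data.Fin using (Fin; zero; suc; _≟_; toℕ; fromℕ<)
open import Data.Fin.Properties using (any?; all?; suc-injective; toℕ-fromℕ<)
open import Data.Bool using (Bool; true; false; if_then_else_; _∧_)
open import Data.Bool.Properties using (¬-not) renaming (_≟_ to _≟𝔹_)
open import Data.Product using (Σ; ∃; _×_; _,_; proj₁; proj₂)
open import Data.Sum using (_⊎_; inj₁; inj₂)
open import Data.Empty using (⊥; ⊥-elim)
open import Data.List using (List; []; _∷_)
open import Data.List.Relation.Unary.All using (All; []; _∷_)
import Data.List.Relation.Unary.All as All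
open import Relation.Nullary using (¬_; Dec; yes; no; does)
open import Relation.Nullary.Decidable using (_×-dec_; _⊎-dec_; ¬?; dec-true; dec-false)
open import Relation.Binary using (tri<; tri≈; tri>)
open import Relation.Binary.PropositionalEquality

Edges : ℕ → ℕ → Set
Edges m n = Fin m → Fin n → Bool

sum-ext : ∀ k {f g : Fin k → ℕ} → (∀ i → f i ≡ g i) → Σ[< k ] f ≡ Σ[< k ] g
sum-ext zero    f≡g = refl
sum-ext (suc k) f≡g = cong₂ _+_ (f≡g zero) (sum-ext k (λ i → f≡g (suc i)))

sum-zero : ∀ k → Σ[< k ] (λ _ → 0) ≡ 0
sum-zero zero    = refl
sum-zero (suc k) = sum-zero k

sum-mono : ∀ k {f g : Fin k → ℕ} → (∀ i → f i ≤ g i) → Σ[< k ] f ≤ Σ[< k ] g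
sum-mono zero    f≤g = z≤n
sum-mono (suc k) f≤g = +-mono-≤ (f≤g zero) (sum-mono k (λ i → f≤g (suc i)))

sum-strict : ∀ k {f g : Fin k → ℕ} (j : Fin k) → (∀ i → f i ≤ g i) → f j < g j →
             Σ[< k ] f < Σ[< k ] g
sum-strict (suc k) zero    f≤g fj<gj = +-mono-<-≤ fj<gj (sum-mono k (λ i → f≤g (suc i)))
sum-strict (suc k) (suc j) f≤g fj<gj = +-mono-≤-< (f≤g zero) (sum-strict k j (λ i → f≤g (suc i)) fj<gj)

sum-bound : ∀ k {f : Fin k → ℕ} → (∀ i → f i ≤ 1) → Σ[< k ] f ≤ k
sum-bound zero    f≤1 = z≤n
sum-bound (suc k) f≤1 = +-mono-≤ (f≤1 zero) (sum-bound k (λ i → f≤1 (suc i)))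

sum-suc-at : ∀ k {f g : Fin k → ℕ} (j : Fin k) → (∀ i → i ≢ j → f i ≡ g i) →
             g j ≡ suc (f j) → Σ[< k ] g ≡ suc (Σ[< k ] f)
sum-suc-at (suc k) zero f≡g gj≡1+fj =
  cong₂ _+_ gj≡1+fj (sym (sum-ext k (λ i → f≡g (suc i) (λ ()))))
sum-suc-at (suc k) {f} {g} (suc j) f≡g gj≡1+fj = begin
  g zero + Σ[< k ] (λ i → g (suc i))       ≡⟨ cong₂ _+_ (sym (f≡g zero (λ ()))) (sum-suc-at k j rest gj≡1+fj) ⟩
  f zero + suc (Σ[< k ] (λ i → f (suc i))) ≡⟨ +-suc (f zero) _ ⟩
  suc (f zero + Σ[< k ] (λ i → f (suc i))) ∎
  where
    open ≡-Reasoning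
    rest : ∀ i → i ≢ j → f (suc i) ≡ g (suc i)
    rest i i≢j = f≡g (suc i) (λ si≡sj → i≢j (suc-injective si≡sj))

both-values : ∀ {b} → b ≡ true → b ≡ false → ⊥
both-values refl ()

does-true : ∀ {P : Set} (P? : Dec P) → does P? ≡ true → P
does-true (yes p) _ = p
does-true (no _)  ()

∧-true : ∀ {p q} → p ∧ q ≡ true → p ≡ true × q ≡ true
∧-true {true} q≡true = refl , q≡true

∧-intro : ∀ {p q} → p ≡ true → q ≡ true → p ∧ q ≡ true
∧-intro refl refl = refl

indicator : Bool → ℕ
indicator b = if b then 1 else 0

degree : ∀ {n} → (Fin n → Bool) → ℕ
degree {n} r = Σ[< n ] (λ b → indicator (r b))

degree-none : ∀ {n} (r : Fin n → Bool) → (∀ b → r b ≡ false) → degree r ≡ 0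
degree-none {n} r none = trans (sum-ext n (λ b → cong indicator (none b))) (sum-zero n)

degree-one : ∀ {n} (r : Fin n → Bool) (y : Fin n) → r y ≡ true →
             (∀ b → r b ≡ true → b ≡ y) → degree r ≡ 1
degree-one {n} r y ry≡true only-y =
  trans (sum-suc-at n {f = λ _ → 0} y zero-off (cong indicator ry≡true)) (cong suc (sum-zero n))
  where
    zero-off : ∀ b → b ≢ y → 0 ≡ indicator (r b)
    zero-off b b≢y with r b in rb
    ... | true  = ⊥-elim (b≢y (only-y b rb))
    ... | false = refl

indicator-mono : ∀ {P Q : Set} (P? : Dec P) (Q? : Dec Q) → (P → Q) →
                 indicator (does P?) ≤ indicator (does Q?)
indicator-mono (yes _) (yes _) _   = ≤-refl
indicator-mono (yes p) (no ¬q) P→Q = ⊥-elim (¬q (P→Q p))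
indicator-mono (no _)  _       _   = z≤n

indicator-strict : ∀ {P Q : Set} (P? : Dec P) (Q? : Dec Q) → ¬ P → Q →
                   indicator (does P?) < indicator (does Q?)
indicator-strict (no _)  (yes _) _  _ = s≤s z≤n
indicator-strict (yes p) _       ¬p _ = ⊥-elim (¬p p)
indicator-strict (no _)  (no ¬q) _  q = ⊥-elim (¬q q)

indicator≤1 : ∀ b → indicator b ≤ 1
indicator≤1 true  = s≤s z≤n
indicator≤1 false = z≤n

sub-isMatching : ∀ {m n} {E M F : Edges m n} → IsMatching E M →
                 (∀ a b → F a b ≡ true → M a b ≡ true) → IsMatching E F
sub-isMatching mM F⊆M = record
  { sub   = λ a b h → sub a b (F⊆M a b h)
  ; uniqX = λ a b b' h h' → uniqX a b b' (F⊆M a b h) (F⊆M a b' h')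
  ; uniqY = λ a a' b h h' → uniqY a a' b (F⊆M a b h) (F⊆M a' b h')
  }
  where open IsMatching mM

restrict : ∀ {m n} {P : Fin m → Fin n → Set} → Edges m n → (∀ a b → Dec (P a b)) → Edges m n
restrict M P? a b = M a b ∧ does (P? a b)

module _ {m n} {P : Fin m → Fin n → Set} (M : Edges m n) (P? : ∀ a b → Dec (P a b)) where

  restrict-sound : ∀ a b → restrict M P? a b ≡ true → M a b ≡ true × P a b
  restrict-sound a b h = proj₁ (∧-true h) , does-true (P? a b) (proj₂ (∧-true h))

  restrict-complete : ∀ a b → M a b ≡ true → P a b → restrict M P? a b ≡ true
  restrict-complete a b Mab p = ∧-intro Mab (dec-true (P? a b) p)

  restrict-isMatching : ∀ {E} → IsMatching E M → IsMatching E (restrict M P?)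
  restrict-isMatching mM = sub-isMatching mM (λ a b h → proj₁ (restrict-sound a b h))

redirect : ∀ {m n} → Edges m n → Fin m → Fin n → Edges m n
redirect M x y a b = if does (a ≟ x) then does (b ≟ y) else M a b

module Redirect {m n} (E M : Edges m n) (x : Fin m) (y : Fin n) where

  elsewhere : ∀ {a} b → a ≢ x → redirect M x y a b ≡ M a b
  elsewhere {a} b a≢x rewrite dec-false (a ≟ x) a≢x = refl

  at-x : ∀ b → redirect M x y x b ≡ does (b ≟ y)
  at-x b rewrite dec-true (x ≟ x) refl = refl

  edge-cases : ∀ a b → redirect M x y a b ≡ true → (a ≡ x × b ≡ y) ⊎ (a ≢ x × M a b ≡ true)
  edge-cases a b h with a ≟ x
  ... | yes a≡x = inj₁ (a≡x , does-true (b ≟ y) h)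
  ... | no  a≢x = inj₂ (a≢x , h)

  isMatching : IsMatching E M → E x y ≡ true → (∀ a → M a y ≡ false) →
               IsMatching E (redirect M x y)
  isMatching mM Exy y-free = record { sub = sb ; uniqX = ux ; uniqY = uy }
    where
      open IsMatching mM
      sb : ∀ a b → redirect M x y a b ≡ true → E a b ≡ true
      sb a b h with edge-cases a b h
      ... | inj₁ (refl , refl) = Exy
      ... | inj₂ (_ , Mab)     = sub a b Mab
      ux : ∀ a b b' → redirect M x y a b ≡ true → redirect M x y a b' ≡ true → b ≡ b'
      ux a b b' h h' with edge-cases a b h | edge-cases a b' h'
      ... | inj₁ (_ , b≡y)   | inj₁ (_ , b'≡y)  = trans b≡y (sym b'≡y)
      ... | inj₁ (a≡x , _)   | inj₂ (a≢x , _)   = ⊥-elim (a≢x a≡x)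
      ... | inj₂ (a≢x , _)   | inj₁ (a≡x , _)   = ⊥-elim (a≢x a≡x)
      ... | inj₂ (_ , Mab)   | inj₂ (_ , Mab')  = uniqX a b b' Mab Mab'
      uy : ∀ a a' b → redirect M x y a b ≡ true → redirect M x y a' b ≡ true → a ≡ a'
      uy a a' b h h' with edge-cases a b h | edge-cases a' b h'
      ... | inj₁ (a≡x , _)    | inj₁ (a'≡x , _)  = trans a≡x (sym a'≡x)
      ... | inj₁ (_ , refl)   | inj₂ (_ , Ma'y)  = ⊥-elim (both-values Ma'y (y-free a'))
      ... | inj₂ (_ , May)    | inj₁ (_ , refl)  = ⊥-elim (both-values May (y-free a))
      ... | inj₂ (_ , Mab)    | inj₂ (_ , Ma'b)  = uniqY a a' b Mab Ma'b

  degree-at-x : degree (redirect M x y x) ≡ 1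
  degree-at-x = degree-one (redirect M x y x) y (trans (at-x y) (dec-true (y ≟ y) refl))
                  (λ b h → does-true (b ≟ y) (trans (sym (at-x b)) h))

  rows-elsewhere : ∀ a → a ≢ x → degree (redirect M x y a) ≡ degree (M a)
  rows-elsewhere a a≢x = sum-ext n (λ b → cong indicator (elsewhere b a≢x))

  size-unmatched : Unmatched M x → size (redirect M x y) ≡ suc (size M)
  size-unmatched x-free =
    sum-suc-at m x (λ a a≢x → sym (rows-elsewhere a a≢x))
      (trans degree-at-x (cong suc (sym (degree-none (M x) x-free))))

  size-matched : ∀ {y'} → IsMatching E M → M x y' ≡ true → size (redirect M x y) ≡ size M
  size-matched {y'} mM Mxy' = sum-ext m row
    where
      row : ∀ a → degree (redirect M x y a) ≡ degree (M a)
      row-x : degree (redirect M x y x) ≡ degree (M x)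
      row-x = trans degree-at-x
                (sym (degree-one (M x) y' Mxy' (λ b Mxb → IsMatching.uniqX mM x b y' Mxb Mxy')))
      row a = by-cases (a ≟ x)
        where
          by-cases : Dec (a ≡ x) → degree (redirect M x y a) ≡ degree (M a)
          by-cases (yes a≡x) = subst (λ a → degree (redirect M x y a) ≡ degree (M a)) (sym a≡x) row-x
          by-cases (no  a≢x) = rows-elsewhere a a≢x

  frees : ∀ {y'} → IsMatching E M → M x y' ≡ true → y ≢ y' → ∀ a → redirect M x y a y' ≡ false
  frees {y'} mM Mxy' y≢y' a with a ≟ x
  ... | yes _   = dec-false (y' ≟ y) (λ y'≡y → y≢y' (sym y'≡y))
  ... | no  a≢x = ¬-not (λ May' → a≢x (IsMatching.uniqY mM a x y' May' Mxy'))

  keeps-column : ∀ {y' b} → IsMatching E M → M x y' ≡ true → y' ≢ b → y ≢ b →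
                 ∀ a → redirect M x y a b ≡ M a b
  keeps-column {y'} {b} mM Mxy' y'≢b y≢b a with a ≟ x
  ... | no _     = refl
  ... | yes refl = trans (dec-false (b ≟ y) (λ b≡y → y≢b (sym b≡y)))
                         (sym (¬-not (λ Mxb → y'≢b (IsMatching.uniqX mM x y' b Mxy' Mxb))))

  keeps-unmatched : ∀ {y'} → M x y' ≡ true → ∀ a → Unmatched M a → Unmatched (redirect M x y) a
  keeps-unmatched {y'} Mxy' a a-free b with a ≟ x
  ... | yes refl = ⊥-elim (both-values Mxy' (a-free y'))
  ... | no  _    = a-free b

module AugmentingPaths {m n} (E : Edges m n) where

  -- AltPath M y ys: an M-alternating path that starts at an M-unmatched
  -- vertex of X and reaches y ∈ Y by an edge of E not in M; ys lists the
  -- earlier Y-vertices (most recent first), each left along its M-edge, and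
  -- all Y-vertices of the path are distinct.
  data AltPath (M : Edges m n) : Fin n → List (Fin n) → Set where
    start : ∀ {x y} → Unmatched M x → E x y ≡ true → M x y ≡ false → AltPath M y []
    step  : ∀ {x y y' ys} → AltPath M y' ys → M x y' ≡ true → E x y ≡ true → M x y ≡ false →
            All (y ≢_) (y' ∷ ys) → AltPath M y (y' ∷ ys)

  end-distinct : ∀ {M y ys} → AltPath M y ys → All (y ≢_) ys
  end-distinct (start _ _ _)      = []
  end-distinct (step _ _ _ _ y∉) = y∉

  transfer : ∀ {M M' y ys} → AltPath M y ys → All (λ b → ∀ a → M' a b ≡ M a b) ys →
             (∀ a → M' a y ≡ true → M a y ≡ true) → (∀ a → Unmatched M a → Unmatched M' a) →
             AltPath M' y ys
  transfer (start {x} x-free Exy Mxy) [] no-new keeps-free =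
    start (keeps-free x x-free) Exy (¬-not (λ M'xy → both-values (no-new x M'xy) Mxy))
  transfer (step {x} p Mxy' Exy Mxy y∉) (same ∷ sames) no-new keeps-free =
    step (transfer p sames (λ a M'ay' → trans (sym (same a)) M'ay') keeps-free)
         (trans (same x) Mxy') Exy (¬-not (λ M'xy → both-values (no-new x M'xy) Mxy)) y∉

  -- An alternating path ending at an M-unmatched vertex gives a larger matching:
  -- redirect its last X-vertex to the end, which shortens the path by one.
  augment : ∀ ys {M y} → IsMatching E M → AltPath M y ys → (∀ a → M a y ≡ false) →
            ∃ λ F → IsMatching E F × size M < size F
  augment [] {M} {y} mM (start {x} x-free Exy _) y-free =
    redirect M x y , isMatching mM Exy y-free , ≤-reflexive (sym (size-unmatched x-free))
    where open Redirect E M x y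
  augment (y' ∷ ys) {M} {y} mM (step {x} p Mxy' Exy _ (y≢y' ∷ y∉ys)) y-free =
    let F , mF , bigger = augment ys (isMatching mM Exy y-free) shorter (frees mM Mxy' y≢y')
    in  F , mF , subst (_< size F) (size-matched mM Mxy') bigger
    where
      open Redirect E M x y
      shorter : AltPath (redirect M x y) y' ys
      shorter = transfer p
        (All.zipWith (λ (y'≢b , y≢b) → keeps-column mM Mxy' y'≢b y≢b) (end-distinct p , y∉ys))
        (λ a h → ⊥-elim (both-values h (frees mM Mxy' y≢y' a)))
        (keeps-unmatched Mxy')

module Alternating {m n} (E M : Edges m n) where

  X : ℕ → Fin m → Set
  X = Xseq E M (Unmatched M)

  Y : ℕ → Fin n → Set
  Y = Yseq E M (Unmatched M)

  U : ℕ → Fin n → Set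
  U i = AltState.Ui (altSeq E M (Unmatched M) i)

  XS : Fin m → Set
  XS x = ∃ λ i → X i x

  YS : Fin n → Set
  YS y = ∃ λ i → Y i y

  decidable : ∀ i → (∀ x → Dec (X i x)) × (∀ y → Dec (Y i y)) × (∀ y → Dec (U i y))
  decidable zero =
    (λ x → all? (λ y → M x y ≟𝔹 false)) , (λ _ → no (λ ())) , (λ _ → no (λ ()))
  decidable (suc i) = X'? , Y'? , (λ y → U? y ⊎-dec Y'? y)
    where
      X? : ∀ x → Dec (X i x)
      X? = proj₁ (decidable i)
      U? : ∀ y → Dec (U i y)
      U? = proj₂ (proj₂ (decidable i))
      Y'? : ∀ y → Dec (Y (suc i) y)
      Y'? y = any? (λ x → X? x ×-dec (E x y ≟𝔹 true) ×-dec (M x y ≟𝔹 false)) ×-dec ¬? (U? y)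
      X'? : ∀ x → Dec (X (suc i) x)
      X'? x = any? (λ y → Y'? y ×-dec (M x y ≟𝔹 true))

  X? : ∀ i x → Dec (X i x)
  X? i = proj₁ (decidable i)

  Y? : ∀ i y → Dec (Y i y)
  Y? i = proj₁ (proj₂ (decidable i))

  U? : ∀ i y → Dec (U i y)
  U? i = proj₂ (proj₂ (decidable i))

  U⊆YS : ∀ i y → U i y → YS y
  U⊆YS (suc i) y (inj₁ u)  = U⊆YS i y u
  U⊆YS (suc i) y (inj₂ yi) = suc i , yi

  Y⊆U : ∀ i j y → Y j y → j ≤ i → U i y
  Y⊆U zero    zero y () _
  Y⊆U (suc i) j y yj j≤1+i with m≤n⇒m<n∨m≡n j≤1+i
  ... | inj₁ (s≤s j≤i) = inj₁ (Y⊆U i j y yj j≤i)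
  ... | inj₂ refl      = inj₂ yj

  -- The Y_i are disjoint, since Y_{i+1} avoids Y₁ ∪ … ∪ Yᵢ.
  Y-disjoint : ∀ i j y → Y i y → Y j y → i ≡ j
  Y-disjoint i j y yi yj with <-cmp i j
  ... | tri≈ _ i≡j _ = i≡j
  Y-disjoint i (suc j) y yi yj | tri< (s≤s i≤j) _ _ = ⊥-elim (proj₂ yj (Y⊆U j i y yi i≤j))
  Y-disjoint (suc i) j y yi yj | tri> _ _ (s≤s j≤i) = ⊥-elim (proj₂ yi (Y⊆U i j y yj j≤i))

  -- The X_i are disjoint: X₀ is unmatched, and X_{i+1} is matched into Y_{i+1}.
  X-disjoint : IsMatching E M → ∀ i j x → X i x → X j x → i ≡ j
  X-disjoint mM zero    zero    x _ _ = refl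
  X-disjoint mM zero    (suc j) x x-free (y , _ , Mxy) = ⊥-elim (both-values Mxy (x-free y))
  X-disjoint mM (suc i) zero    x (y , _ , Mxy) x-free = ⊥-elim (both-values Mxy (x-free y))
  X-disjoint mM (suc i) (suc j) x (y , yi , Mxy) (y' , yj , Mxy')
    with IsMatching.uniqX mM x y y' Mxy Mxy'
  ... | refl = Y-disjoint (suc i) (suc j) y yi yj

  seen : ℕ → ℕ
  seen i = Σ[< n ] (λ y → indicator (does (U? i y)))

  -- Each nonempty step discovers a new Y-vertex, so stage i is either
  -- empty or has already seen at least i vertices of Y.
  progress : ∀ i → i ≤ seen i ⊎ (∀ x → ¬ X i x)
  progress zero = inj₁ z≤n
  progress (suc i) with progress i
  ... | inj₂ Xi-empty = inj₂ (λ { x (y , ((x' , x'i , _) , _) , _) → Xi-empty x' x'i })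
  ... | inj₁ i≤seen with any? (Y? (suc i))
  ...   | no  no-y       = inj₂ (λ { x (y , yi , _) → no-y (y , yi) })
  ...   | yes (y , yi) = inj₁ (≤-trans (s≤s i≤seen)
            (sum-strict n y (λ z → indicator-mono (U? i z) (U? (suc i) z) inj₁)
                            (indicator-strict (U? i y) (U? (suc i) y) (proj₂ yi) (inj₂ yi))))

  X-bound : ∀ i x → X i x → i ≤ n
  X-bound i x xi with progress i
  ... | inj₁ i≤seen   = ≤-trans i≤seen (sum-bound n (λ y → indicator≤1 _))
  ... | inj₂ Xi-empty = ⊥-elim (Xi-empty x xi)

  Y-bound : ∀ i y → Y i y → 1 ≤ i × i ≤ suc n
  Y-bound (suc i) y ((x , xi , _) , _) = s≤s z≤n , s≤s (X-bound i x xi)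

  -- Membership in X_S is decidable: only the stages i ≤ n can contain x.
  XS? : ∀ x → Dec (XS x)
  XS? x with any? (λ (j : Fin (suc n)) → X? (toℕ j) x)
  ... | yes (j , xj) = yes (toℕ j , xj)
  ... | no  none     = no λ (i , xi) →
    let i<1+n = s≤s (X-bound i x xi)
    in  none (fromℕ< i<1+n , subst (λ k → X k x) (sym (toℕ-fromℕ< i<1+n)) xi)

  open AugmentingPaths E

  path-to : ∀ i y → Y (suc i) y → Σ (List (Fin n)) λ ys → AltPath M y ys × All (U (suc i)) (y ∷ ys)
  path-to zero y yi@((x , x-free , Exy , Mxy) , _) = [] , start x-free Exy Mxy , (inj₂ yi ∷ [])
  path-to (suc i) y yi@((x , (y' , y'i , Mxy') , Exy , Mxy) , y∉U) =
    let ys , p , inU = path-to i y' y'i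
    in  y' ∷ ys
      , step p Mxy' Exy Mxy (All.map (λ {z} z∈U y≡z → y∉U (subst (U (suc i)) (sym y≡z) z∈U)) inU)
      , inj₂ yi ∷ All.map inj₁ inU

module Maximum {m n} (E M : Edges m n) (mm : IsMaximumMatching E M) where
  open IsMaximumMatching mm
  open IsMatching matching
  open Alternating E M
  open AugmentingPaths E

  -- No augmenting path: every vertex of Y_S is M-matched.
  Y-matched : ∀ i y → Y (suc i) y → ∃ λ x → M x y ≡ true
  Y-matched i y yi with any? (λ x → M x y ≟𝔹 true)
  ... | yes matched = matched
  ... | no  y-free  =
    let ys , p , _  = path-to i y yi
        F , mF , bigger = augment ys matching p (λ a → ¬-not (λ May → y-free (a , May)))
    in  ⊥-elim (<⇒≱ bigger (maximum F mF))

  no-edge-XS-YL : ∀ x y → XS x → ¬ YS y → E x y ≡ false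
  no-edge-XS-YL x y (i , xi) y∉YS = ¬-not (λ Exy → y∉YS (neighbour i xi Exy (M x y) refl))
    where
      neighbour : ∀ i → X i x → E x y ≡ true → ∀ b → M x y ≡ b → YS y
      neighbour zero    x-free _ true Mxy = ⊥-elim (both-values Mxy (x-free y))
      neighbour (suc i) (y' , y'i , Mxy') _ true Mxy with uniqX x y' y Mxy' Mxy
      ... | refl = suc i , y'i
      neighbour i xi Exy false Mxy with U? i y
      ... | yes y∈U = U⊆YS i y y∈U
      ... | no  y∉U = suc i , ((x , xi , Exy , Mxy) , y∉U)

  perfect-at : ∀ i → Σ (Edges m n) λ F →
                 IsMatchingIn E (X (suc i)) (Y (suc i)) F
                 × (∀ x → X (suc i) x → ∃ λ y → F x y ≡ true)
                 × (∀ y → Y (suc i) y → ∃ λ x → F x y ≡ true)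
  perfect-at i = F , record { matching = restrict-isMatching M inY matching ; inside = inside }
                   , covers-X , covers-Y
    where
      inY : ∀ (a : Fin m) b → Dec (Y (suc i) b)
      inY _ = Y? (suc i)
      F : Edges m n
      F = restrict M inY
      inside : ∀ a b → F a b ≡ true → X (suc i) a × Y (suc i) b
      inside a b h = let Mab , bi = restrict-sound M inY a b h in (b , bi , Mab) , bi
      covers-X : ∀ x → X (suc i) x → ∃ λ y → F x y ≡ true
      covers-X x (y , yi , Mxy) = y , restrict-complete M inY x y Mxy yi
      covers-Y : ∀ y → Y (suc i) y → ∃ λ x → F x y ≡ true
      covers-Y y yi = let x , Mxy = Y-matched i y yi in x , restrict-complete M inY x y Mxy yi

  path-saturated : YPathSaturated E XS YS
  path-saturated = record
    { k       = suc n
    ; k≥1     = s≤s z≤n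
    ; As      = X
    ; Bs      = Y
    ; As-sub  = λ i x xi → m≤n⇒m≤1+n (X-bound i x xi) , (i , xi)
    ; As-cov  = λ x x∈XS → x∈XS
    ; As-disj = X-disjoint matching
    ; Bs-sub  = λ i y yi → proj₁ (Y-bound i y yi) , proj₂ (Y-bound i y yi) , (i , yi)
    ; Bs-cov  = λ y y∈YS → y∈YS
    ; Bs-disj = Y-disjoint
    ; perfect = λ { (suc i) _ _ → perfect-at i }
    ; back    = λ { i y ((x , xi , Exy , _) , _) → x , xi , Exy }
    }

  saturates-XL : ∃ λ F → IsMatchingIn E (λ x → ¬ XS x) (λ y → ¬ YS y) F
                         × (∀ x → ¬ XS x → ∃ λ y → F x y ≡ true)
  saturates-XL = F , record { matching = restrict-isMatching M inXL matching ; inside = inside }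
                   , saturated
    where
      inXL : ∀ a (b : Fin n) → Dec (¬ XS a)
      inXL a _ = ¬? (XS? a)
      F : Edges m n
      F = restrict M inXL
      -- an M-partner of a vertex of Y_j lies in X_j
      inside : ∀ a b → F a b ≡ true → ¬ XS a × ¬ YS b
      inside a b h =
        let Mab , a∉XS = restrict-sound M inXL a b h
        in  a∉XS , λ { (suc j , bj) → a∉XS (suc j , b , bj , Mab) }
      -- a vertex outside X_S is not in X₀, hence matched
      saturated : ∀ x → ¬ XS x → ∃ λ y → F x y ≡ true
      saturated x x∉XS with any? (λ y → M x y ≟𝔹 true)
      ... | yes (y , Mxy) = y , restrict-complete M inXL x y Mxy x∉XS
      ... | no  x-free    = ⊥-elim (x∉XS (zero , λ y → ¬-not (λ Mxy → x-free (y , Mxy))))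

lemma2p2 : (m n : ℕ) (E M : Fin m → Fin n → Bool) → IsMaximumMatching E M →
    let XS : Fin m → Set
        XS x = ∃ λ i → Xseq E M (Unmatched M) i x
        YS : Fin n → Set
        YS y = ∃ λ i → Yseq E M (Unmatched M) i y
        XL : Fin m → Set
        XL x = ¬ XS x
        YL : Fin n → Set
        YL y = ¬ YS y
    in (∀ x y → XS x → YL y → E x y ≡ false)
       × YPathSaturated E XS YS
       × (∃ λ F → IsMatchingIn E XL YL F × (∀ x → XL x → ∃ λ y → F x y ≡ true))
lemma2p2 m n E M mm = no-edge-XS-YL , path-saturated , saturates-XL
  where open Maximum E M mm
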